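{- Let $P=([n],\preceq)$ be a poset with exactly $t$ maximal elements, $w$ a weight on $\mathbb{F}_q$, and let $k_i=k$ for all $i\in[n]$, $N=nk$. Then the number of $x\in\mathbb{F}_q^N$ with $w_{(P,w,\pi)}(x)=nM_w$ is $\big(q^k-(q-|D_{M_w}|)^k\big)^t\,q^{k(n-t)}$.
   Context: A weight on $\mathbb{F}_q$ is a map $w:\mathbb{F}_q\to\mathbb{N}\cup\{0\}$ with $w(\alpha)=0$ iff $\alpha=0$, $w(-\alpha)=w(\alpha)$, $w(\alpha+\beta)\le w(\alpha)+w(\beta)$; $M_w=\max_\alpha w(\alpha)$; $D_{M_w}=\{\alpha\in\mathbb{F}_q:w(\alpha)=M_w\}$; $\tilde w^k(v)=\max_s w(v_s)$ for $v\in\mathbb{F}_q^k$. Ideals of $P$ are down-closed subsets and $\langle A\rangle$ is the ideal generated by $A$. Writing $x=x_1\oplus\cdots\oplus x_n\in(\mathbb{F}_q^{k})^{\oplus n}$, $supp_\pi(x)=\{i:x_i\ne0\}$, $I_x=\langle supp_\pi(x)\rangle$, $M_x$ the set of maximal elements of $I_x$, and $w_{(P,w,\pi)}(x)=\sum_{i\in M_x}\tilde w^{k}(x_i)+|I_x\setminus M_x|\,M_w$. -}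

module Defs where

open import Level using (0ℓ)
open import Data.Bool using (Bool; true; false; not; _∧_; _∨_; if_then_else_)
open import Data.Nat using (ℕ; zero; suc; _⊔_; _≡ᵇ_)
import Data.Nat as ℕ
open import Data.Fin using (Fin)
import Data.Fin as Fin
open import Data.List using (List; []; _∷_; [_]; map; foldr; length; filterᵇ; allFin; concatMap)
open import Data.Nat.ListAction using (sum)
open import Data.Bool.ListAction using (all; any)
open import Data.List.Relation.Unary.Unique.Propositional using (Unique)
open import Data.List.Membership.Propositional using (_∈_)
open import Data.Product using (∃)
open import Data.Vec.Functional using (Vector)
import Data.Vec.Functional as VF
open import Relation.Binary using (Rel; Decidable; DecidableEquality)
open import Relation.Binary.PropositionalEquality using (_≡_; _≢_)
open import Relation.Nullary.Decidable using (⌊_⌋)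
open import Algebra.Structures using (IsCommutativeRing)

record FiniteField : Set₁ where
  infixl 6 _+_
  infixl 7 _*_
  field
    Carrier : Set
    _+_ _*_ : Carrier → Carrier → Carrier
    -_ : Carrier → Carrier
    0# 1# : Carrier
    isCommutativeRing : IsCommutativeRing _≡_ _+_ _*_ -_ 0# 1#
    0≢1 : 0# ≢ 1#
    inverse : ∀ x → x ≢ 0# → ∃ λ y → x * y ≡ 1#
    _≟_ : DecidableEquality Carrier
    elements : List Carrier
    elements-unique : Unique elements
    elements-complete : ∀ x → x ∈ elements

  q : ℕ
  q = length elements

module _ (F : FiniteField) where
  open FiniteField F

  record IsWeight (w : Carrier → ℕ) : Set where
    field
      w≡0⇒0 : ∀ α → w α ≡ 0 → α ≡ 0#
      w0 : w 0# ≡ 0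
      symmetric : ∀ α → w (- α) ≡ w α
      triangle : ∀ α β → w (α + β) ℕ.≤ w α ℕ.+ w β

  Mw : (Carrier → ℕ) → ℕ
  Mw w = foldr _⊔_ 0 (map w elements)

  cardD : (Carrier → ℕ) → ℕ
  cardD w = length (filterᵇ (λ a → w a ≡ᵇ Mw w) elements)

  allVectors : {A : Set} → List A → (m : ℕ) → List (Vector A m)
  allVectors xs zero = [ VF.[] ]
  allVectors xs (suc m) = concatMap (λ a → map (a VF.∷_) (allVectors xs m)) xs

  -- elements of (F_q^k)^{⊕ n} ≅ F_q^{nk}
  allBlockVectors : (n k : ℕ) → List (Vector (Vector Carrier k) n)
  allBlockVectors n k = allVectors (allVectors elements k) n

  isZeroᵇ : Carrier → Bool
  isZeroᵇ a = ⌊ a ≟ 0# ⌋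

  wTilde : (w : Carrier → ℕ) (k : ℕ) → Vector Carrier k → ℕ
  wTilde w k v = foldr _⊔_ 0 (map (λ s → w (v s)) (allFin k))

  module PosetWeight (w : Carrier → ℕ) (n k : ℕ)
                     (_≼_ : Rel (Fin n) 0ℓ) (_≼?_ : Decidable _≼_) where

    _≼ᵇ_ : Fin n → Fin n → Bool
    i ≼ᵇ j = ⌊ i ≼? j ⌋

    _==ᵇ_ : Fin n → Fin n → Bool
    i ==ᵇ j = ⌊ i Fin.≟ j ⌋

    isMaximalᵇ : Fin n → Bool
    isMaximalᵇ i = all (λ j → not (i ≼ᵇ j) ∨ (j ==ᵇ i)) (allFin n)

    numMaximal : ℕ
    numMaximal = length (filterᵇ isMaximalᵇ (allFin n))

    module _ (x : Vector (Vector Carrier k) n) where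
      inSupp : Fin n → Bool
      inSupp i = not (all (λ s → isZeroᵇ (x i s)) (allFin k))

      inI : Fin n → Bool
      inI j = any (λ i → inSupp i ∧ (j ≼ᵇ i)) (allFin n)

      inM : Fin n → Bool
      inM j = inI j ∧ all (λ j' → not (inI j' ∧ (j ≼ᵇ j') ∧ not (j' ==ᵇ j))) (allFin n)

      weightPwπ : ℕ
      weightPwπ = sum (map (λ i → if inM i then wTilde w k (x i) else 0) (allFin n))
                  ℕ.+ length (filterᵇ (λ i → inI i ∧ not (inM i)) (allFin n)) ℕ.* Mw w

    countMaxWeight : ℕ
    countMaxWeight = length (filterᵇ (λ x → weightPwπ x ≡ᵇ n ℕ.* Mw w) (allBlockVectors n k))

{-# OPTIONS --safe #-}
-- Every weight is at most M_w > 0, so each index contributes at most M_w to w_(P,w,π)(x)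
-- (w̃(x_i) on M_x, M_w on I_x ∖ M_x), and the weight is n M_w exactly when I_x = [n] and
-- w̃(x_i) = M_w on M_x. As every element of a finite poset lies below a maximal one, this
-- happens iff w̃(x_m) = M_w for every maximal m: that already forces x_m ≠ 0, hence
-- I_x = [n] and M_x = max P. The condition is blockwise, so the count is a product:
-- q^k − (q − |D_{M_w}|)^k blocks (those with an entry of weight M_w) at each of the t
-- maximal indices, and all q^k blocks at the other n − t.
module Submission where

open import Defs
open import Level using (0ℓ)
open import Data.Nat using (ℕ; _*_; _∸_; _^_)
open import Data.Fin using (Fin)
open import Relation.Binary using (Rel; Decidable; IsPartialOrder)
open import Relation.Binary.PropositionalEquality using (_≡_)

open import Data.Bool using (Bool; true; false; T; not; _∧_; _∨_; if_then_else_)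
open import Data.Bool.ListAction using (and; all; any)
open import Data.Bool.Properties using (T-∧)
open import Data.Empty using (⊥-elim)
open import Data.Fin using (zero; suc)
import Data.Fin as Fin
open import Data.Fin.Properties using (all?; ¬∀⟶∃¬)
open import Data.List using (List; []; _∷_; _++_; map; foldr; concatMap; length; filterᵇ; allFin)
open import Data.List.Properties using (filter-≐; filter-++; length-++; length-filter; length-tabulate; map-cong; map-tabulate)
open import Data.List.Membership.Propositional using (_∈_)
open import Data.List.Membership.Propositional.Properties using (∈-allFin)
import Data.List.Relation.Unary.All as All
open import Data.List.Relation.Unary.All.Properties using (all⁺; all⁻)
import Data.List.Relation.Unary.Any as Any
open import Data.List.Relation.Unary.Any using (here; there)
open import Data.List.Relation.Unary.Any.Properties using (any⁺)
open import Data.Nat using (zero; suc; _⊔_; _+_; _≤_; _<_; _≡ᵇ_; z≤n; s≤s)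
open import Data.Nat.ListAction using (sum; product)
open import Data.Nat.Properties
open import Algebra.Properties.CommutativeSemigroup +-commutativeSemigroup using () renaming (interchange to +-interchange)
open import Algebra.Properties.CommutativeSemigroup *-commutativeSemigroup using () renaming (x∙yz≈y∙xz to *-x∙yz≈y∙xz)
open import Data.Product using (_×_; _,_; proj₁; proj₂; ∃)
open import Data.Sum using (inj₁; inj₂)
import Data.Vec.Functional as VF
open VF using (Vector)
open import Function using (id; _∘_; _⇔_; mk⇔; Equivalence)
open import Function.Properties.Equivalence using () renaming (refl to ⇔-refl)
open import Relation.Nullary using (¬_; Dec; yes; no; contradiction)
open import Relation.Nullary.Decidable using (⌊_⌋; T?; _→-dec_; fromWitness; toWitness)
open import Relation.Binary.PropositionalEquality using (refl; sym; trans; cong; cong₂; subst; module ≡-Reasoning)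

open Equivalence using (to; from)

count : {A : Set} → (A → Bool) → List A → ℕ
count p xs = length (filterᵇ p xs)

module _ {A : Set} where

  count-cong : ∀ {p r : A → Bool} → (∀ x → T (p x) ⇔ T (r x)) → ∀ xs → count p xs ≡ count r xs
  count-cong {p} {r} p⇔r xs =
    cong length (filter-≐ (T? ∘ p) (T? ∘ r) ((λ {x} → to (p⇔r x)) , (λ {x} → from (p⇔r x))) xs)

  count-≗ : ∀ {p r : A → Bool} → (∀ x → p x ≡ r x) → ∀ xs → count p xs ≡ count r xs
  count-≗ {p} p≗r = count-cong (λ x → subst (λ b → T (p x) ⇔ T b) (p≗r x) ⇔-refl)

  count-∷ : ∀ (p : A → Bool) x xs → count p (x ∷ xs) ≡ (if p x then suc (count p xs) else count p xs)
  count-∷ p x xs with p x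
  ... | true = refl
  ... | false = refl

  count-true : ∀ xs → count (λ (_ : A) → true) xs ≡ length xs
  count-true [] = refl
  count-true (x ∷ xs) = cong suc (count-true xs)

  count-≤-length : ∀ (p : A → Bool) xs → count p xs ≤ length xs
  count-≤-length p = length-filter (T? ∘ p)

  count-++ : ∀ (p : A → Bool) xs ys → count p (xs ++ ys) ≡ count p xs + count p ys
  count-++ p xs ys = trans (cong length (filter-++ (T? ∘ p) xs ys)) (length-++ (filterᵇ p xs))

  count-+-count-not : ∀ (p : A → Bool) xs → count p xs + count (not ∘ p) xs ≡ length xs
  count-+-count-not p [] = refl
  count-+-count-not p (x ∷ xs) with p x
  ... | true = cong suc (count-+-count-not p xs)
  ... | false = trans (+-suc (count p xs) _) (cong suc (count-+-count-not p xs))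

  count-not-∨ : ∀ b (r : A → Bool) xs → count (λ x → not b ∨ r x) xs ≡ (if b then count r xs else length xs)
  count-not-∨ true r xs = refl
  count-not-∨ false r xs = count-true xs

  count≡length∸count-not : ∀ (p : A → Bool) xs → count p xs ≡ length xs ∸ count (not ∘ p) xs
  count≡length∸count-not p xs =
    trans (sym (m+n∸n≡m (count p xs) (count (not ∘ p) xs)))
          (cong (_∸ count (not ∘ p) xs) (count-+-count-not p xs))

  count-not≡length∸count : ∀ (p : A → Bool) xs → count (not ∘ p) xs ≡ length xs ∸ count p xs
  count-not≡length∸count p xs =
    trans (sym (m+n∸m≡n (count p xs) (count (not ∘ p) xs)))
          (cong (_∸ count p xs) (count-+-count-not p xs))

  count-mono : ∀ {p r : A → Bool} → (∀ x → T (p x) → T (r x)) → ∀ xs → count p xs ≤ count r xs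
  count-mono p⇒r [] = z≤n
  count-mono {p} {r} p⇒r (x ∷ xs) with p x | r x | p⇒r x
  ... | true  | true  | _   = s≤s (count-mono p⇒r xs)
  ... | true  | false | p⇒r = ⊥-elim (p⇒r _)
  ... | false | true  | _   = m≤n⇒m≤1+n (count-mono p⇒r xs)
  ... | false | false | _   = count-mono p⇒r xs

  count-< : ∀ {p r : A → Bool} → (∀ x → T (p x) → T (r x)) →
            ∀ {z xs} → z ∈ xs → T (r z) → ¬ T (p z) → count p xs < count r xs
  count-< {p} {r} p⇒r {z} {.z ∷ xs} (here refl) rz ¬pz with p z | r z
  ... | true  | _    = contradiction _ ¬pz
  ... | false | true = s≤s (count-mono p⇒r xs)
  count-< {p} {r} p⇒r {z} {x ∷ xs} (there z∈xs) rz ¬pz with p x | r x | p⇒r x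
  ... | true  | true  | _   = s≤s (count-< p⇒r z∈xs rz ¬pz)
  ... | true  | false | p⇒r = ⊥-elim (p⇒r _)
  ... | false | true  | _   = m≤n⇒m≤1+n (count-< p⇒r z∈xs rz ¬pz)
  ... | false | false | _   = count-< p⇒r z∈xs rz ¬pz

  count-map : ∀ {B : Set} (p : B → Bool) (f : A → B) xs → count p (map f xs) ≡ count (p ∘ f) xs
  count-map p f [] = refl
  count-map p f (x ∷ xs) with p (f x)
  ... | true = cong suc (count-map p f xs)
  ... | false = count-map p f xs

  count-∧ : ∀ b (r : A → Bool) xs → count (λ x → b ∧ r x) xs ≡ (if b then count r xs else 0)
  count-∧ true r xs = refl
  count-∧ false r [] = refl
  count-∧ false r (x ∷ xs) = count-∧ false r xs

  product-map-const : ∀ c xs → product (map (λ (_ : A) → c) xs) ≡ c ^ length xs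
  product-map-const c [] = refl
  product-map-const c (x ∷ xs) = cong (c *_) (product-map-const c xs)

  product-map-if : ∀ (b : A → Bool) a c xs →
    product (map (λ x → if b x then a else c) xs) ≡ a ^ count b xs * c ^ (length xs ∸ count b xs)
  product-map-if b a c [] = refl
  product-map-if b a c (x ∷ xs) with b x
  ... | true = trans (cong (a *_) (product-map-if b a c xs)) (sym (*-assoc a _ _))
  ... | false = begin
      c * product (map (λ x → if b x then a else c) xs) ≡⟨ cong (c *_) (product-map-if b a c xs) ⟩
      c * (a ^ t * c ^ (length xs ∸ t))                 ≡⟨ *-x∙yz≈y∙xz c (a ^ t) _ ⟩
      a ^ t * c ^ suc (length xs ∸ t)
        ≡⟨ cong (λ e → a ^ t * c ^ e) (sym (+-∸-assoc 1 (count-≤-length b xs))) ⟩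
      a ^ t * c ^ (suc (length xs) ∸ t)                 ∎
    where
      open ≡-Reasoning
      t = count b xs

  sum-map-+ : ∀ (f g : A → ℕ) xs → sum (map (λ x → f x + g x) xs) ≡ sum (map f xs) + sum (map g xs)
  sum-map-+ f g [] = refl
  sum-map-+ f g (x ∷ xs) = trans (cong (f x + g x +_) (sum-map-+ f g xs)) (+-interchange (f x) (g x) _ _)

  count-*-as-sum : ∀ (h : A → Bool) M xs → count h xs * M ≡ sum (map (λ x → if h x then M else 0) xs)
  count-*-as-sum h M [] = refl
  count-*-as-sum h M (x ∷ xs) with h x
  ... | true = cong (M +_) (count-*-as-sum h M xs)
  ... | false = count-*-as-sum h M xs

  sum-map-≤ : ∀ (f : A → ℕ) {M} → (∀ x → f x ≤ M) → ∀ xs → sum (map f xs) ≤ length xs * M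
  sum-map-≤ f f≤M [] = z≤n
  sum-map-≤ f f≤M (x ∷ xs) = +-mono-≤ (f≤M x) (sum-map-≤ f f≤M xs)

  sum-map-≡-const : ∀ (f : A → ℕ) {M} → (∀ x → f x ≡ M) → ∀ xs → sum (map f xs) ≡ length xs * M
  sum-map-≡-const f f≡M [] = refl
  sum-map-≡-const f f≡M (x ∷ xs) = cong₂ _+_ (f≡M x) (sum-map-≡-const f f≡M xs)

  sum-map-≡-const⁻ : ∀ (f : A → ℕ) {M} → (∀ x → f x ≤ M) →
                     ∀ xs → sum (map f xs) ≡ length xs * M → ∀ {x} → x ∈ xs → f x ≡ M
  sum-map-≡-const⁻ f f≤M (y ∷ xs) sum≡ x∈ with m≤n⇒m<n∨m≡n (f≤M y)
  ... | inj₁ fy<M = contradiction sum≡ (<⇒≢ (+-mono-<-≤ fy<M (sum-map-≤ f f≤M xs)))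
  sum-map-≡-const⁻ f f≤M (y ∷ xs) sum≡ (here refl) | inj₂ fy≡M = fy≡M
  sum-map-≡-const⁻ f f≤M (y ∷ xs) sum≡ (there x∈) | inj₂ fy≡M =
    sum-map-≡-const⁻ f f≤M xs (+-cancelˡ-≡ _ _ _ (trans (cong (_+ _) (sym fy≡M)) sum≡)) x∈

maxMap : {A : Set} → (A → ℕ) → List A → ℕ
maxMap g xs = foldr _⊔_ 0 (map g xs)

module _ {A : Set} (g : A → ℕ) where

  ≤-maxMap : ∀ {x xs} → x ∈ xs → g x ≤ maxMap g xs
  ≤-maxMap {xs = y ∷ xs} (here refl) = m≤m⊔n (g y) _
  ≤-maxMap {xs = y ∷ xs} (there x∈) = ≤-trans (≤-maxMap x∈) (m≤n⊔m (g y) _)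

  maxMap-≤ : ∀ {M} → (∀ x → g x ≤ M) → ∀ xs → maxMap g xs ≤ M
  maxMap-≤ g≤M [] = z≤n
  maxMap-≤ g≤M (y ∷ xs) = ⊔-lub (g≤M y) (maxMap-≤ g≤M xs)

  maxMap-attained : ∀ {M} xs → 0 < M → maxMap g xs ≡ M → ∃ λ x → g x ≡ M
  maxMap-attained [] 0<M max≡M = contradiction max≡M (<⇒≢ 0<M)
  maxMap-attained (y ∷ xs) 0<M max≡M with ⊔-sel (g y) (maxMap g xs)
  ... | inj₁ max≡gy = y , trans (sym max≡gy) max≡M
  ... | inj₂ max≡rest = maxMap-attained xs 0<M (trans (sym max≡rest) max≡M)

length-allFin : ∀ n → length (allFin n) ≡ n
length-allFin n = length-tabulate id

map-allFin-suc : ∀ {A : Set} {m} (f : Fin (suc m) → A) →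
                 map f (allFin (suc m)) ≡ f zero ∷ map (f ∘ suc) (allFin m)
map-allFin-suc f = cong (f zero ∷_) (trans (map-tabulate suc f) (sym (map-tabulate id (f ∘ suc))))

all-allFin⁺ : ∀ {m} (p : Fin m → Bool) → (∀ i → T (p i)) → T (all p (allFin m))
all-allFin⁺ {m} p pi = all⁻ p {xs = allFin m} (All.tabulate (λ {i} _ → pi i))

all-allFin⁻ : ∀ {m} (p : Fin m → Bool) → T (all p (allFin m)) → ∀ i → T (p i)
all-allFin⁻ p all-p i = All.lookup (all⁺ p _ all-p) (∈-allFin i)

any-allFin⁺ : ∀ {m} (p : Fin m → Bool) i → T (p i) → T (any p (allFin m))
any-allFin⁺ p i pi = any⁺ p (Any.map (λ { refl → pi }) (∈-allFin i))

module _ (F : FiniteField) {A : Set} (xs : List A) where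

  count-allVectors : ∀ m (p : Fin m → A → Bool) →
    count (λ v → all (λ i → p i (v i)) (allFin m)) (allVectors F xs m)
      ≡ product (map (λ i → count (p i) xs) (allFin m))
  count-allVectors zero p = refl
  count-allVectors (suc m) p = begin
      count P (allVectors F xs (suc m))       ≡⟨ count-cons-blocks xs ⟩
      count (p zero) xs * count Q L           ≡⟨ cong (count (p zero) xs *_) (count-allVectors m (p ∘ suc)) ⟩
      count (p zero) xs * product (map (λ i → count (p (suc i)) xs) (allFin m))
                                              ≡⟨ cong product (sym (map-allFin-suc (λ i → count (p i) xs))) ⟩
      product (map (λ i → count (p i) xs) (allFin (suc m))) ∎
    where
      open ≡-Reasoning
      L : List (Vector A m)
      L = allVectors F xs m
      P : Vector A (suc m) → Bool
      P v = all (λ i → p i (v i)) (allFin (suc m))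
      Q : Vector A m → Bool
      Q v = all (λ i → p (suc i) (v i)) (allFin m)

      count-cons : ∀ a → count P (map (a VF.∷_) L) ≡ (if p zero a then count Q L else 0)
      count-cons a = begin
        count P (map (a VF.∷_) L)              ≡⟨ count-map P (a VF.∷_) L ⟩
        count (P ∘ (a VF.∷_)) L
          ≡⟨ count-≗ (λ v → cong and (map-allFin-suc (λ i → p i ((a VF.∷ v) i)))) L ⟩
        count (λ v → p zero a ∧ Q v) L         ≡⟨ count-∧ (p zero a) Q L ⟩
        (if p zero a then count Q L else 0)   ∎

      count-cons-blocks : ∀ ys → count P (concatMap (λ a → map (a VF.∷_) L) ys)
                                 ≡ count (p zero) ys * count Q L
      count-cons-blocks [] = refl
      count-cons-blocks (a ∷ ys) = begin
        count P (map (a VF.∷_) L ++ concatMap (λ a → map (a VF.∷_) L) ys)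
            ≡⟨ count-++ P (map (a VF.∷_) L) _ ⟩
        count P (map (a VF.∷_) L) + count P (concatMap (λ a → map (a VF.∷_) L) ys)
            ≡⟨ cong₂ _+_ (count-cons a) (count-cons-blocks ys) ⟩
        (if p zero a then count Q L else 0) + count (p zero) ys * count Q L
            ≡⟨ if-+-* (p zero a) ⟩
        (if p zero a then suc (count (p zero) ys) else count (p zero) ys) * count Q L
            ≡⟨ cong (_* count Q L) (sym (count-∷ (p zero) a ys)) ⟩
        count (p zero) (a ∷ ys) * count Q L ∎
        where
          if-+-* : ∀ b → (if b then count Q L else 0) + count (p zero) ys * count Q L
                         ≡ (if b then suc (count (p zero) ys) else count (p zero) ys) * count Q L
          if-+-* true = refl
          if-+-* false = refl

  length-allVectors : ∀ m → length (allVectors F xs m) ≡ length xs ^ m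
  length-allVectors m = begin
    length (allVectors F xs m)
      ≡⟨ sym (count-true (allVectors F xs m)) ⟩
    count (λ _ → true) (allVectors F xs m)
      ≡⟨ count-cong (λ _ → mk⇔ (λ _ → all-allFin⁺ {m} (λ _ → true) _) _) (allVectors F xs m) ⟩
    count (λ v → all (λ _ → true) (allFin m)) (allVectors F xs m)
      ≡⟨ count-allVectors m (λ _ _ → true) ⟩
    product (map (λ _ → count (λ _ → true) xs) (allFin m))
      ≡⟨ product-map-const (count (λ _ → true) xs) (allFin m) ⟩
    count (λ _ → true) xs ^ length (allFin m)
      ≡⟨ cong₂ _^_ (count-true xs) (length-allFin m) ⟩
    length xs ^ m ∎
    where open ≡-Reasoning

T-not : ∀ {b} → T (not b) ⇔ (¬ T b)
T-not {true} = mk⇔ (λ ()) (λ ¬t → ¬t _)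
T-not {false} = mk⇔ (λ _ ()) _

T-not-∨ : ∀ {a b} → T (not a ∨ b) ⇔ (T a → T b)
T-not-∨ {true} = mk⇔ (λ tb _ → tb) (λ a⇒b → a⇒b _)
T-not-∨ {false} = mk⇔ (λ _ ()) _

module _ {A B : Set} where

  T-not-∨-⌊⌋ : (a? : Dec A) (b? : Dec B) → T (not ⌊ a? ⌋ ∨ ⌊ b? ⌋) ⇔ (A → B)
  T-not-∨-⌊⌋ (yes a) (yes b) = mk⇔ (λ _ _ → b) _
  T-not-∨-⌊⌋ (yes a) (no ¬b) = mk⇔ (λ ()) (λ a⇒b → ¬b (a⇒b a))
  T-not-∨-⌊⌋ (no ¬a) _       = mk⇔ (λ _ a → contradiction a ¬a) _

  T-not-∧-⌊⌋ : ∀ {c} (a? : Dec A) (b? : Dec B) → T c → T (not (c ∧ ⌊ a? ⌋ ∧ not ⌊ b? ⌋)) ⇔ (A → B)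
  T-not-∧-⌊⌋ {true} (yes a) (yes b) _ = mk⇔ (λ _ _ → b) _
  T-not-∧-⌊⌋ {true} (yes a) (no ¬b) _ = mk⇔ (λ ()) (λ a⇒b → ¬b (a⇒b a))
  T-not-∧-⌊⌋ {true} (no ¬a) _       _ = mk⇔ (λ _ a → contradiction a ¬a) _

contribution : (inI inM : Bool) → ℕ → ℕ → ℕ
contribution inI inM a M = (if inM then a else 0) + (if inI ∧ not inM then M else 0)

contribution-≤ : ∀ inI inM {a M} → (T inM → T inI) → a ≤ M → contribution inI inM a M ≤ M
contribution-≤ true  true  {a} _ a≤M = subst (_≤ _) (sym (+-identityʳ a)) a≤M
contribution-≤ false true  M⇒I _ = ⊥-elim (M⇒I _)
contribution-≤ true  false _ _ = ≤-refl
contribution-≤ false false _ _ = z≤n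

contribution-≡ : ∀ inI inM {a M} → 0 < M → (T inM → T inI) →
                 contribution inI inM a M ≡ M ⇔ (T inI × (T inM → a ≡ M))
contribution-≡ true  true  {a} _ _ = mk⇔ (λ a+0≡M → _ , λ _ → trans (sym (+-identityʳ a)) a+0≡M)
                                        (λ (_ , a≡M) → trans (+-identityʳ a) (a≡M _))
contribution-≡ false true  _ M⇒I = ⊥-elim (M⇒I _)
contribution-≡ true  false _ _ = mk⇔ (λ _ → _ , λ ()) (λ _ → refl)
contribution-≡ false false 0<M _ = mk⇔ (λ 0≡M → contradiction 0≡M (<⇒≢ 0<M)) (λ ())

module FinitePoset {n} {_≼_ : Rel (Fin n) 0ℓ} (po : IsPartialOrder _≡_ _≼_) (_≼?_ : Decidable _≼_) where

  open IsPartialOrder po using (antisym) renaming (refl to ≼-refl; trans to ≼-trans)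

  Maximal : Fin n → Set
  Maximal m = ∀ j → m ≼ j → j ≡ m

  upSetSize : Fin n → ℕ
  upSetSize j = count (λ y → ⌊ j ≼? y ⌋) (allFin n)

  nonMaximal⇒strictlyAbove : ∀ {j} → ¬ Maximal j → ∃ λ j' → j ≼ j' × ¬ j' ≡ j
  nonMaximal⇒strictlyAbove {j} ¬max with ¬∀⟶∃¬ n _ (λ j' → (j ≼? j') →-dec (j' Fin.≟ j)) ¬max
  ... | j' , ¬[j≼j'⇒j'≡j] with j ≼? j'
  ...   | yes j≼j' = j' , j≼j' , λ j'≡j → ¬[j≼j'⇒j'≡j] (λ _ → j'≡j)
  ...   | no j⋠j' = contradiction (λ j≼j' → contradiction j≼j' j⋠j') ¬[j≼j'⇒j'≡j]

  upSetSize-< : ∀ {j j'} → j ≼ j' → ¬ j' ≡ j → upSetSize j' < upSetSize j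
  upSetSize-< {j} {j'} j≼j' j'≢j =
    count-< (λ y j'≼y → fromWitness (≼-trans j≼j' (toWitness j'≼y))) (∈-allFin j)
            (fromWitness ≼-refl) (λ j'≼j → j'≢j (antisym (toWitness j'≼j) j≼j'))

  maximal-above : ∀ j → ∃ λ m → Maximal m × j ≼ m
  maximal-above j = go (suc (upSetSize j)) j ≤-refl
    where
      go : ∀ fuel j → upSetSize j < fuel → ∃ λ m → Maximal m × j ≼ m
      go zero j ()
      go (suc fuel) j up<fuel with all? (λ j' → (j ≼? j') →-dec (j' Fin.≟ j))
      ... | yes max = j , max , ≼-refl
      ... | no ¬max with nonMaximal⇒strictlyAbove ¬max
      ...   | j' , j≼j' , j'≢j with go fuel j' (<-≤-trans (upSetSize-< j≼j' j'≢j) (≤-pred up<fuel))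
      ...     | m , max , j'≼m = m , max , ≼-trans j≼j' j'≼m

module MaximumWeight (F : FiniteField) {w : FiniteField.Carrier F → ℕ} (isWeight : IsWeight F w) where

  open FiniteField F using (Carrier; 0#; 1#; 0≢1; elements; elements-complete; q)
  open IsWeight isWeight using (w≡0⇒0; w0)

  w≤Mw : ∀ a → w a ≤ Mw F w
  w≤Mw a = ≤-maxMap w (elements-complete a)

  0<Mw : 0 < Mw F w
  0<Mw = <-≤-trans (n≢0⇒n>0 (λ w1≡0 → 0≢1 (sym (w≡0⇒0 1# w1≡0)))) (w≤Mw 1#)

  w≡Mw⇒≢0 : ∀ {a} → w a ≡ Mw F w → ¬ a ≡ 0#
  w≡Mw⇒≢0 {a} wa≡Mw a≡0 = <⇒≢ 0<Mw (trans (sym w0) (subst (λ b → w b ≡ Mw F w) a≡0 wa≡Mw))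

  wTilde-≤ : ∀ {k} v → wTilde F w k v ≤ Mw F w
  wTilde-≤ {k} v = maxMap-≤ (w ∘ v) (λ s → w≤Mw (v s)) (allFin k)

  wTilde≡Mw⇔ : ∀ {k} (v : Vector Carrier k) → wTilde F w k v ≡ Mw F w ⇔ (∃ λ s → w (v s) ≡ Mw F w)
  wTilde≡Mw⇔ {k} v = mk⇔ (maxMap-attained (w ∘ v) (allFin k) 0<Mw) λ (s , w[vs]≡Mw) →
    ≤-antisym (wTilde-≤ v) (subst (_≤ wTilde F w k v) w[vs]≡Mw (≤-maxMap (w ∘ v) (∈-allFin s)))

  count-wTilde≡Mw : ∀ k → count (λ v → wTilde F w k v ≡ᵇ Mw F w) (allVectors F elements k)
                          ≡ q ^ k ∸ (q ∸ cardD F w) ^ k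
  count-wTilde≡Mw k = begin
      count maxBlock blocks                       ≡⟨ count≡length∸count-not maxBlock blocks ⟩
      length blocks ∸ count (not ∘ maxBlock) blocks
        ≡⟨ cong₂ _∸_ (length-allVectors F elements k) (count-cong notMaxBlock⇔ blocks) ⟩
      q ^ k ∸ count (λ v → all (λ s → not (maxEntry (v s))) (allFin k)) blocks
        ≡⟨ cong (q ^ k ∸_) (count-allVectors F elements k (λ _ → not ∘ maxEntry)) ⟩
      q ^ k ∸ product (map (λ _ → count (not ∘ maxEntry) elements) (allFin k))
        ≡⟨ cong (q ^ k ∸_) (product-map-const _ (allFin k)) ⟩
      q ^ k ∸ count (not ∘ maxEntry) elements ^ length (allFin k)
        ≡⟨ cong₂ (λ c l → q ^ k ∸ c ^ l) (count-not≡length∸count maxEntry elements) (length-allFin k) ⟩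
      q ^ k ∸ (q ∸ cardD F w) ^ k                ∎
    where
      open ≡-Reasoning
      blocks : List (Vector Carrier k)
      blocks = allVectors F elements k
      maxEntry : Carrier → Bool
      maxEntry a = w a ≡ᵇ Mw F w
      maxBlock : Vector Carrier k → Bool
      maxBlock v = wTilde F w k v ≡ᵇ Mw F w

      notMaxBlock⇔ : ∀ v → T (not (maxBlock v)) ⇔ T (all (λ s → not (maxEntry (v s))) (allFin k))
      notMaxBlock⇔ v = mk⇔
        (λ ¬max → all-allFin⁺ _ λ s → from T-not λ max[vs] →
           to T-not ¬max (≡⇒≡ᵇ _ _ (from (wTilde≡Mw⇔ v) (s , ≡ᵇ⇒≡ _ _ max[vs]))))
        (λ ¬max[v-] → from T-not λ max →
           let s , w[vs]≡Mw = to (wTilde≡Mw⇔ v) (≡ᵇ⇒≡ _ _ max)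
           in to T-not (all-allFin⁻ _ ¬max[v-] s) (≡⇒≡ᵇ _ _ w[vs]≡Mw))

  module OverPoset {n k : ℕ} {_≼_ : Rel (Fin n) 0ℓ} (po : IsPartialOrder _≡_ _≼_) (_≼?_ : Decidable _≼_) where

    open PosetWeight F w n k _≼_ _≼?_
    open FinitePoset po _≼?_

    isMaximalᵇ⇔Maximal : ∀ m → T (isMaximalᵇ m) ⇔ Maximal m
    isMaximalᵇ⇔Maximal m = mk⇔
      (λ max j → to (T-not-∨-⌊⌋ (m ≼? j) (j Fin.≟ m)) (all-allFin⁻ _ max j))
      (λ max → all-allFin⁺ _ λ j → from (T-not-∨-⌊⌋ (m ≼? j) (j Fin.≟ m)) (max j))

    module _ (x : Vector (Vector Carrier k) n) where

      inSupp-intro : ∀ {i} s → ¬ x i s ≡ 0# → T (inSupp x i)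
      inSupp-intro s x[is]≢0 = from T-not λ allZero → x[is]≢0 (toWitness (all-allFin⁻ _ allZero s))

      inI-intro : ∀ {i j} → T (inSupp x i) → j ≼ i → T (inI x j)
      inI-intro {i} i∈supp j≼i = any-allFin⁺ _ i (from T-∧ (i∈supp , fromWitness j≼i))

      inM⇒inI : ∀ j → T (inM x j) → T (inI x j)
      inM⇒inI j = proj₁ ∘ to T-∧

      inM⇔Maximal : (∀ j → T (inI x j)) → ∀ j → T (inM x j) ⇔ Maximal j
      inM⇔Maximal I-full j = mk⇔
        (λ j∈M j' → to (above⇔ j') (all-allFin⁻ _ (proj₂ (to T-∧ j∈M)) j'))
        (λ max → from T-∧ (I-full j , all-allFin⁺ _ λ j' → from (above⇔ j') (max j')))
        where
          above⇔ : ∀ j' → T (not (inI x j' ∧ ⌊ j ≼? j' ⌋ ∧ not ⌊ j' Fin.≟ j ⌋))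
                          ⇔ (j ≼ j' → j' ≡ j)
          above⇔ j' = T-not-∧-⌊⌋ (j ≼? j') (j' Fin.≟ j) (I-full j')

      contributionOf : Fin n → ℕ
      contributionOf i = contribution (inI x i) (inM x i) (wTilde F w k (x i)) (Mw F w)

      weight≡sum-contribution : weightPwπ x ≡ sum (map contributionOf (allFin n))
      weight≡sum-contribution = begin
        sum (map fromM (allFin n)) + count fromI∖M (allFin n) * Mw F w
          ≡⟨ cong (sum (map fromM (allFin n)) +_) (count-*-as-sum fromI∖M (Mw F w) (allFin n)) ⟩
        sum (map fromM (allFin n)) + sum (map (λ i → if fromI∖M i then Mw F w else 0) (allFin n))
          ≡⟨ sum-map-+ fromM _ (allFin n) ⟨
        sum (map contributionOf (allFin n)) ∎
        where
          open ≡-Reasoning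
          fromM : Fin n → ℕ
          fromM i = if inM x i then wTilde F w k (x i) else 0
          fromI∖M : Fin n → Bool
          fromI∖M i = inI x i ∧ not (inM x i)

      weight≡max⇔ : weightPwπ x ≡ n * Mw F w
                    ⇔ (∀ i → T (inI x i) × (T (inM x i) → wTilde F w k (x i) ≡ Mw F w))
      weight≡max⇔ = mk⇔
        (λ weight≡max i → to (contribution≡⇔ i) (sum-map-≡-const⁻ contributionOf contribution≤ (allFin n)
            (trans (sym weight≡sum-contribution) (trans weight≡max n*Mw≡)) (∈-allFin i)))
        (λ full → trans weight≡sum-contribution (trans (sum-map-≡-const contributionOf
            (λ i → from (contribution≡⇔ i) (full i)) (allFin n)) (sym n*Mw≡)))
        where
          contribution≤ : ∀ i → contributionOf i ≤ Mw F w
          contribution≤ i = contribution-≤ (inI x i) (inM x i) (inM⇒inI i) (wTilde-≤ (x i))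
          contribution≡⇔ : ∀ i → contributionOf i ≡ Mw F w ⇔
                                   (T (inI x i) × (T (inM x i) → wTilde F w k (x i) ≡ Mw F w))
          contribution≡⇔ i = contribution-≡ (inI x i) (inM x i) 0<Mw (inM⇒inI i)
          n*Mw≡ : n * Mw F w ≡ length (allFin n) * Mw F w
          n*Mw≡ = cong (_* Mw F w) (sym (length-allFin n))

      weight≡max⇔maximalBlocks : weightPwπ x ≡ n * Mw F w
                                 ⇔ (∀ m → Maximal m → wTilde F w k (x m) ≡ Mw F w)
      weight≡max⇔maximalBlocks = mk⇔
        (λ weight≡max m max → let full = to weight≡max⇔ weight≡max in
           proj₂ (full m) (from (inM⇔Maximal (proj₁ ∘ full) m) max))
        (λ maxBlocks → let I-full = inI-full maxBlocks in
           from weight≡max⇔ λ j → I-full j , λ j∈M → maxBlocks j (to (inM⇔Maximal I-full j) j∈M))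
        where
          inI-full : (∀ m → Maximal m → wTilde F w k (x m) ≡ Mw F w) → ∀ j → T (inI x j)
          inI-full maxBlocks j =
            let m , max , j≼m = maximal-above j
                s , w[xms]≡Mw = to (wTilde≡Mw⇔ (x m)) (maxBlocks m max)
            in inI-intro (inSupp-intro s (w≡Mw⇒≢0 w[xms]≡Mw)) j≼m

    admissible : Fin n → Vector Carrier k → Bool
    admissible i v = not (isMaximalᵇ i) ∨ (wTilde F w k v ≡ᵇ Mw F w)

    weight≡maxᵇ⇔admissible : ∀ x → T (weightPwπ x ≡ᵇ n * Mw F w)
                                   ⇔ T (all (λ i → admissible i (x i)) (allFin n))
    weight≡maxᵇ⇔admissible x = mk⇔
      (λ weight≡max → all-allFin⁺ _ λ i → from T-not-∨ λ i-max →
        ≡⇒≡ᵇ _ _ (to (weight≡max⇔maximalBlocks x) (≡ᵇ⇒≡ _ _ weight≡max) i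
                    (to (isMaximalᵇ⇔Maximal i) i-max)))
      (λ adm → ≡⇒≡ᵇ _ _ (from (weight≡max⇔maximalBlocks x) λ m max →
        ≡ᵇ⇒≡ _ _ (to T-not-∨ (all-allFin⁻ _ adm m) (from (isMaximalᵇ⇔Maximal m) max))))

    count-admissible : ∀ i → count (admissible i) (allVectors F elements k)
                             ≡ (if isMaximalᵇ i then q ^ k ∸ (q ∸ cardD F w) ^ k else q ^ k)
    count-admissible i =
      trans (count-not-∨ (isMaximalᵇ i) (λ v → wTilde F w k v ≡ᵇ Mw F w) (allVectors F elements k))
            (cong₂ (λ a c → if isMaximalᵇ i then a else c) (count-wTilde≡Mw k) (length-allVectors F elements k))

corollary3p1 : (F : FiniteField) (n k : ℕ)
    (_≼_ : Rel (Fin n) 0ℓ) → IsPartialOrder _≡_ _≼_ → (_≼?_ : Decidable _≼_)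
    (w : FiniteField.Carrier F → ℕ) → IsWeight F w →
    (t : ℕ) → PosetWeight.numMaximal F w n k _≼_ _≼?_ ≡ t →
    PosetWeight.countMaxWeight F w n k _≼_ _≼?_
      ≡ ((FiniteField.q F ^ k) ∸ ((FiniteField.q F ∸ cardD F w) ^ k)) ^ t
        * FiniteField.q F ^ (k * (n ∸ t))
corollary3p1 F n k _≼_ po _≼?_ w isWeight _ refl = begin
    countMaxWeight
      ≡⟨ count-cong weight≡maxᵇ⇔admissible (allBlockVectors F n k) ⟩
    count (λ x → all (λ i → admissible i (x i)) (allFin n)) (allVectors F blocks n)
      ≡⟨ count-allVectors F blocks n admissible ⟩
    product (map (λ i → count (admissible i) blocks) (allFin n))
      ≡⟨ cong product (map-cong count-admissible (allFin n)) ⟩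
    product (map (λ i → if isMaximalᵇ i then A else q ^ k) (allFin n))
      ≡⟨ product-map-if isMaximalᵇ A (q ^ k) (allFin n) ⟩
    A ^ numMaximal * (q ^ k) ^ (length (allFin n) ∸ numMaximal)
      ≡⟨ cong (λ l → A ^ numMaximal * (q ^ k) ^ (l ∸ numMaximal)) (length-allFin n) ⟩
    A ^ numMaximal * (q ^ k) ^ (n ∸ numMaximal)
      ≡⟨ cong (A ^ numMaximal *_) (^-*-assoc q k (n ∸ numMaximal)) ⟩
    A ^ numMaximal * q ^ (k * (n ∸ numMaximal)) ∎
  where
    open ≡-Reasoning
    open FiniteField F using (elements; q)
    open PosetWeight F w n k _≼_ _≼?_
    open MaximumWeight F isWeight
    open OverPoset {n} {k} po _≼?_
    blocks : List (Vector (FiniteField.Carrier F) k)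
    blocks = allVectors F elements k
    A : ℕ
    A = q ^ k ∸ (q ∸ cardD F w) ^ k
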